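{- Let $D$ be an $\mathrm{STS}_2(v)$ on $\mathbb{F}_2^v$. Then $D$ does not have an automorphism of order $3$ of type $A_{v,f}$ with $f\equiv 2\pmod 3$.
   Context: An $\mathrm{STS}_2(v)$ on $V=\mathbb{F}_2^v$ is a set of $3$-dimensional subspaces (blocks) of $V$ such that every $2$-dimensional subspace of $V$ lies in exactly one block. $\mathrm{GL}(v,2)$ acts on subspaces via $\mathbf{x}\mapsto\mathbf{x}A$; an automorphism of $D$ is a matrix $A\in\mathrm{GL}(v,2)$ mapping $D$ to itself. For $f\in\{0,\ldots,v-1\}$ with $v-f$ even, $A_{v,f}$ is the block-diagonal matrix consisting of $\frac{v-f}{2}$ blocks $\begin{pmatrix}0&1\\1&1\end{pmatrix}$ followed by $I_f$; every element of order $3$ of $\mathrm{GL}(v,2)$ is conjugate to exactly one $A_{v,f}$, called its type. -}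

module Defs where

open import Data.Bool using (Bool; true; false; _xor_; _∧_; not; if_then_else_)
open import Data.Nat using (ℕ; zero; suc; _+_; _^_; _<ᵇ_; _≡ᵇ_; _∸_; _/_; _%_)
open import Data.Fin using (Fin; toℕ)
open import Data.Vec using (Vec; []; _∷_; zipWith; replicate; map; foldr′; tabulate)
open import Data.List using (List; [_]; _++_)
open import Data.Nat.ListAction using (sum)
import Data.List as L
open import Data.Product using (Σ; ∃; _×_)
open import Function.Bundles using (_⇔_)
open import Relation.Binary.PropositionalEquality using (_≡_; _≢_)

-- Vectors of F₂^v are Vec Bool v (false = 0, true = 1, xor = +, ∧ = ·).
F2^ : ℕ → Set
F2^ v = Vec Bool v

_⊕_ : ∀ {v} → F2^ v → F2^ v → F2^ v
_⊕_ = zipWith _xor_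

0ᵥ : ∀ {v} → F2^ v
0ᵥ = replicate _ false

-- v × v matrices over F₂, given as the list of their rows.
Mat : ℕ → Set
Mat v = Vec (Vec Bool v) v

-- row vector times matrix: x A = Σ_i x_i (row i of A)
_·_ : ∀ {v} → F2^ v → Mat v → F2^ v
x · A = foldr′ _⊕_ 0ᵥ (zipWith (λ b row → map (b ∧_) row) x A)

_⊗_ : ∀ {v} → Mat v → Mat v → Mat v
A ⊗ B = map (λ r → r · B) A

I : ∀ {v} → Mat v
I = tabulate λ i → tabulate λ j → toℕ i ≡ᵇ toℕ j

Invertible : ∀ {v} → Mat v → Set
Invertible {v} A = Σ (Mat v) λ B → (A ⊗ B ≡ I) × (B ⊗ A ≡ I)

HasOrder3 : ∀ {v} → Mat v → Set
HasOrder3 A = (A ⊗ (A ⊗ A) ≡ I) × (A ≢ I)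

-- The matrix A_{v,f}: (v-f)/2 diagonal blocks [[0,1],[1,1]] followed by I_f.
-- Entry (i,j) with indices i,j < v; m = v ∸ f.
Aentry : ℕ → ℕ → ℕ → Bool
Aentry m i j with i <ᵇ m | j <ᵇ m
... | true  | true  = ((i / 2) ≡ᵇ (j / 2)) ∧ not (((i % 2) ≡ᵇ 0) ∧ ((j % 2) ≡ᵇ 0))
... | false | false = i ≡ᵇ j
... | _     | _     = false

A[_,_] : (v f : ℕ) → Mat v
A[ v , f ] = tabulate λ i → tabulate λ j → Aentry (v ∸ f) (toℕ i) (toℕ j)

-- A is conjugate in GL(v,2) to A_{v,f}: P⁻¹ A P = A_{v,f} for some invertible P
OfType : (v f : ℕ) → Mat v → Set
OfType v f A = Σ (Mat v) λ P → Invertible P × (A ⊗ P ≡ P ⊗ A[ v , f ])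

-- Subsets of F₂^v as Boolean characteristic functions
Pred : ℕ → Set
Pred v = F2^ v → Bool

allVecs : (v : ℕ) → List (F2^ v)
allVecs zero = [ [] ]
allVecs (suc v) = L.map (false ∷_) (allVecs v) ++ L.map (true ∷_) (allVecs v)

size : ∀ {v} → Pred v → ℕ
size {v} S = sum (L.map (λ x → if S x then 1 else 0) (allVecs v))

record IsSubspace {v : ℕ} (k : ℕ) (S : Pred v) : Set where
  field
    zero∈  : S 0ᵥ ≡ true
    closed : ∀ x y → S x ≡ true → S y ≡ true → S (x ⊕ y) ≡ true
    card   : size S ≡ 2 ^ k

_⊆_ : ∀ {v} → Pred v → Pred v → Set
S ⊆ T = ∀ x → S x ≡ true → T x ≡ true

record STS2 (v : ℕ) : Set where
  field
    b        : ℕ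
    block    : Fin b → Pred v
    blockDim : ∀ i → IsSubspace 3 (block i)
    unique   : ∀ T → IsSubspace 2 T →
               Σ (Fin b) λ i → (T ⊆ block i) × (∀ j → T ⊆ block j → j ≡ i)

IsImage : ∀ {v} → Pred v → Mat v → Pred v → Set
IsImage {v} B A C = ∀ y → (C y ≡ true) ⇔ (∃ λ (x : F2^ v) → (B x ≡ true) × (x · A ≡ y))

IsAutomorphism : ∀ {v} → STS2 v → Mat v → Set
IsAutomorphism D A = Invertible A ×
  (∀ i → Σ (Fin (STS2.b D)) λ j → IsImage (STS2.block D i) A (STS2.block D j))

module Submission where

-- The vectors fixed by an automorphism A of type A_{v,f} form a subspace with 2^f elements. Two distinct
-- nonzero fixed vectors span a 2-subspace lying in a unique block B; A maps B to a block containing the same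
-- 2-subspace, i.e. to B itself, and an order-3 linear map of the 3-space B fixing a 2-subspace fixes B pointwise.
-- Hence the ordered pairs of distinct nonzero fixed vectors are partitioned by the pointwise fixed blocks, each
-- contributing 7 · 6 of them, and 7 divides (2^f − 1)(2^f − 2). But for f = 3q + 2 we have 2^f = 4 · 8^q ≡ 4
-- (mod 7), so this product is ≡ 3 · 2 = 6 (mod 7).

open import Defs

open import Algebra.Bundles using (CommutativeMonoid)
import Algebra.Properties.CommutativeSemigroup as CommutativeSemigroupProperties
open import Data.Bool using (Bool; true; false; _xor_; _∧_; _∨_; not; if_then_else_)
import Data.Bool.Properties as Bool
open import Data.Bool.Properties
  using (∧-conicalˡ; ∧-conicalʳ; ∧-zeroʳ; ∧-identityʳ; ∧-distribʳ-xor; not-injective;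
         xor-assoc; xor-comm; xor-identityˡ; xor-identityʳ; xor-same)
open import Data.Empty using (⊥-elim)
open import Data.Fin using (Fin; toℕ)
open import Data.List using (List; []; _∷_; _++_; length; allFin)
import Data.List as List
import Data.List.Properties as List
open import Data.List.Membership.Propositional using (_∈_)
open import Data.List.Membership.Propositional.Properties
  using (∈-++⁺ˡ; ∈-++⁺ʳ; ∈-++⁻; ∈-map⁺; ∈-map⁻; ∈-allFin)
open import Data.List.Membership.Propositional.Properties.WithK using (unique∧set⇒bag)
open import Data.List.Relation.Binary.BagAndSetEquality using (∼bag⇒↭)
open import Data.List.Relation.Binary.Permutation.Propositional using (_↭_)
open import Data.List.Relation.Binary.Permutation.Propositional.Properties using () renaming (map⁺ to ↭-map⁺)
open import Data.List.Relation.Unary.All using ([]; _∷_)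
import Data.List.Relation.Unary.All as All
open import Data.List.Relation.Unary.All.Properties using (All¬⇒¬Any)
open import Data.List.Relation.Unary.AllPairs using ([]; _∷_)
open import Data.List.Relation.Unary.Any using (here; there)
open import Data.List.Relation.Unary.Unique.Propositional using (Unique)
import Data.List.Relation.Unary.Unique.Propositional.Properties as Unique
open import Data.Nat using (ℕ; zero; suc; _+_; _*_; _∸_; _^_; _<_; _≤_; _%_; _/_; _<ᵇ_; s≤s; z≤n)
open import Data.Nat.Divisibility using (_∣_; _∣?_; divides; _∣0; ∣-refl; m∣m*n; ∣m∣n⇒∣m+n; ∣m+n∣m⇒∣n)
open import Data.Nat.DivMod using (m≡m%n+[m/n]*n; m/n≡1+[m∸n]/n; %-remove-+ˡ)
open import Data.Nat.ListAction using (sum)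
open import Data.Nat.ListAction.Properties using (sum-++; sum-↭)
open import Data.Nat.Properties
  using (<⇒≤; *-comm; ^-*-assoc; m∸n+n≡m; +-suc; +-identityʳ; +-cancelˡ-≡; *-distribʳ-+; +-commutativeSemigroup)
open import Data.Nat.Tactic.RingSolver using (solve-∀)
open import Data.Product using (Σ; ∃; ∃₂; _×_; _,_; proj₁; proj₂)
open import Data.Sum using (inj₁; inj₂)
open import Data.Vec using (Vec; []; _∷_; zipWith; replicate; map; foldr′; tabulate)
open import Data.Vec.Properties
  using (≡-dec; ∷-injectiveʳ; zipWith-assoc; zipWith-comm; zipWith-identityˡ; zipWith-identityʳ;
         map-id; map-const; map-replicate; map-∘; tabulate-∘; tabulate-cong)
open import Function using (_∘_)
open import Function.Bundles using (_⇔_; mk⇔; Equivalence)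
open import Relation.Binary.Definitions using (DecidableEquality)
open import Relation.Binary.PropositionalEquality
open import Relation.Nullary using (¬_; Dec; yes; no; does; contradiction)
open import Relation.Nullary.Decidable using (from-no; ¬?; dec-true; dec-false; does-⇔; map′; _→-dec_)

open CommutativeSemigroupProperties +-commutativeSemigroup using () renaming (interchange to +-interchange)
module ∧ = CommutativeSemigroupProperties (CommutativeMonoid.commutativeSemigroup Bool.∧-commutativeMonoid)

-- Linear algebra over F₂

⊕-assoc : ∀ {n} (x y z : F2^ n) → (x ⊕ y) ⊕ z ≡ x ⊕ (y ⊕ z)
⊕-assoc = zipWith-assoc xor-assoc

⊕-comm : ∀ {n} (x y : F2^ n) → x ⊕ y ≡ y ⊕ x
⊕-comm = zipWith-comm xor-comm

⊕-identityˡ : ∀ {n} (x : F2^ n) → 0ᵥ ⊕ x ≡ x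
⊕-identityˡ = zipWith-identityˡ xor-identityˡ

⊕-identityʳ : ∀ {n} (x : F2^ n) → x ⊕ 0ᵥ ≡ x
⊕-identityʳ = zipWith-identityʳ xor-identityʳ

⊕-self : ∀ {n} (x : F2^ n) → x ⊕ x ≡ 0ᵥ
⊕-self []      = refl
⊕-self (a ∷ x) = cong₂ _∷_ (xor-same a) (⊕-self x)

⊕-cancelˡ : ∀ {n} (x y : F2^ n) → x ⊕ (x ⊕ y) ≡ y
⊕-cancelˡ x y = begin
  x ⊕ (x ⊕ y)  ≡⟨ ⊕-assoc x x y ⟨
  (x ⊕ x) ⊕ y  ≡⟨ cong (_⊕ y) (⊕-self x) ⟩
  0ᵥ ⊕ y       ≡⟨ ⊕-identityˡ y ⟩
  y            ∎
  where open ≡-Reasoning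

⊕-cancelʳ : ∀ {n} (x y : F2^ n) → (x ⊕ y) ⊕ y ≡ x
⊕-cancelʳ x y = trans (⊕-assoc x y y) (trans (cong (x ⊕_) (⊕-self y)) (⊕-identityʳ x))

⊕-injectiveˡ : ∀ {n} (x : F2^ n) {y z : F2^ n} → x ⊕ y ≡ x ⊕ z → y ≡ z
⊕-injectiveˡ x {y} {z} e = trans (sym (⊕-cancelˡ x y)) (trans (cong (x ⊕_) e) (⊕-cancelˡ x z))

⊕-interchange : ∀ {n} (a b c d : F2^ n) → (a ⊕ b) ⊕ (c ⊕ d) ≡ (a ⊕ c) ⊕ (b ⊕ d)
⊕-interchange a b c d = begin
  (a ⊕ b) ⊕ (c ⊕ d)  ≡⟨ ⊕-assoc a b (c ⊕ d) ⟩
  a ⊕ (b ⊕ (c ⊕ d))  ≡⟨ cong (a ⊕_) (⊕-assoc b c d) ⟨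
  a ⊕ ((b ⊕ c) ⊕ d)  ≡⟨ cong (λ t → a ⊕ (t ⊕ d)) (⊕-comm b c) ⟩
  a ⊕ ((c ⊕ b) ⊕ d)  ≡⟨ cong (a ⊕_) (⊕-assoc c b d) ⟩
  a ⊕ (c ⊕ (b ⊕ d))  ≡⟨ ⊕-assoc a c (b ⊕ d) ⟨
  (a ⊕ c) ⊕ (b ⊕ d)  ∎
  where open ≡-Reasoning

-- Rectangular version of _·_ (which is the square case definitionally), needed for induction on rows.
infixl 25 _·ᵣ_
_·ᵣ_ : ∀ {m n} → F2^ m → Vec (F2^ n) m → F2^ n
x ·ᵣ A = foldr′ _⊕_ 0ᵥ (zipWith (λ b row → map (b ∧_) row) x A)

scale : ∀ {n} → Bool → F2^ n → F2^ n
scale b = map (b ∧_)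

scale-false : ∀ {n} (x : F2^ n) → scale false x ≡ 0ᵥ
scale-false x = map-const x false

scale-true : ∀ {n} (x : F2^ n) → scale true x ≡ x
scale-true = map-id

scale-0ᵥ : ∀ {n} b → scale b (0ᵥ {n}) ≡ 0ᵥ
scale-0ᵥ {n} b = trans (map-replicate (b ∧_) false n) (cong (replicate n) (∧-zeroʳ b))

scale-xor : ∀ {n} a b (x : F2^ n) → scale (a xor b) x ≡ scale a x ⊕ scale b x
scale-xor a b []      = refl
scale-xor a b (c ∷ x) = cong₂ _∷_ (∧-distribʳ-xor c a b) (scale-xor a b x)

·ᵣ-zeroˡ : ∀ {m n} (A : Vec (F2^ n) m) → 0ᵥ ·ᵣ A ≡ 0ᵥ
·ᵣ-zeroˡ []      = refl
·ᵣ-zeroˡ (r ∷ A) = trans (cong₂ _⊕_ (scale-false r) (·ᵣ-zeroˡ A)) (⊕-identityˡ 0ᵥ)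

·ᵣ-distrib-⊕ : ∀ {m n} (x y : F2^ m) (A : Vec (F2^ n) m) → (x ⊕ y) ·ᵣ A ≡ x ·ᵣ A ⊕ y ·ᵣ A
·ᵣ-distrib-⊕ []      []      []      = sym (⊕-identityˡ 0ᵥ)
·ᵣ-distrib-⊕ (a ∷ x) (b ∷ y) (r ∷ A) = begin
  scale (a xor b) r ⊕ (x ⊕ y) ·ᵣ A
    ≡⟨ cong₂ _⊕_ (scale-xor a b r) (·ᵣ-distrib-⊕ x y A) ⟩
  (scale a r ⊕ scale b r) ⊕ (x ·ᵣ A ⊕ y ·ᵣ A)
    ≡⟨ ⊕-interchange (scale a r) (scale b r) (x ·ᵣ A) (y ·ᵣ A) ⟩
  (scale a r ⊕ x ·ᵣ A) ⊕ (scale b r ⊕ y ·ᵣ A)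
    ∎
  where open ≡-Reasoning

·ᵣ-scale : ∀ {m n} b (x : F2^ m) (A : Vec (F2^ n) m) → scale b x ·ᵣ A ≡ scale b (x ·ᵣ A)
·ᵣ-scale false x A = trans (cong (_·ᵣ A) (scale-false x)) (trans (·ᵣ-zeroˡ A) (sym (scale-false _)))
·ᵣ-scale true  x A = trans (cong (_·ᵣ A) (scale-true x)) (sym (scale-true _))

·ᵣ-assoc : ∀ {m n k} (x : F2^ m) (A : Vec (F2^ n) m) (B : Vec (F2^ k) n) →
           (x ·ᵣ A) ·ᵣ B ≡ x ·ᵣ map (_·ᵣ B) A
·ᵣ-assoc []      []      B = ·ᵣ-zeroˡ B
·ᵣ-assoc (a ∷ x) (r ∷ A) B =
  trans (·ᵣ-distrib-⊕ (scale a r) (x ·ᵣ A) B) (cong₂ _⊕_ (·ᵣ-scale a r B) (·ᵣ-assoc x A B))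

·ᵣ-map-false∷ : ∀ {m n} (x : F2^ m) (A : Vec (F2^ n) m) → x ·ᵣ map (false ∷_) A ≡ false ∷ x ·ᵣ A
·ᵣ-map-false∷ []      []      = refl
·ᵣ-map-false∷ (a ∷ x) (r ∷ A) rewrite ·ᵣ-map-false∷ x A =
  cong (_∷ scale a r ⊕ x ·ᵣ A) (trans (xor-identityʳ (a ∧ false)) (∧-zeroʳ a))

tabulate-false : ∀ {n} → tabulate {n = n} (λ _ → false) ≡ 0ᵥ
tabulate-false {zero}  = refl
tabulate-false {suc n} = cong (false ∷_) tabulate-false

I-suc : ∀ {n} → I {suc n} ≡ (true ∷ 0ᵥ) ∷ map (false ∷_) I
I-suc = cong₂ _∷_ (cong (true ∷_) tabulate-false) (tabulate-∘ (false ∷_) _)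

·-identityʳ : ∀ {n} (x : F2^ n) → x · I ≡ x
·-identityʳ []      = refl
·-identityʳ (a ∷ x) = begin
  (a ∷ x) ·ᵣ I
    ≡⟨ cong ((a ∷ x) ·ᵣ_) I-suc ⟩
  scale a (true ∷ 0ᵥ) ⊕ x ·ᵣ map (false ∷_) I
    ≡⟨ cong₂ _⊕_ (cong (_ ∷_) (scale-0ᵥ a)) (·ᵣ-map-false∷ x I) ⟩
  ((a ∧ true) ∷ 0ᵥ) ⊕ (false ∷ x ·ᵣ I)
    ≡⟨ cong₂ _∷_ (trans (xor-identityʳ _) (∧-identityʳ a)) (⊕-identityˡ _) ⟩
  a ∷ x ·ᵣ I
    ≡⟨ cong (a ∷_) (·-identityʳ x) ⟩
  a ∷ x
    ∎
  where open ≡-Reasoning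

·-assoc : ∀ {n} (x : F2^ n) (A B : Mat n) → (x · A) · B ≡ x · (A ⊗ B)
·-assoc = ·ᵣ-assoc

·-distrib-⊕ : ∀ {n} (x y : F2^ n) (A : Mat n) → (x ⊕ y) · A ≡ (x · A) ⊕ (y · A)
·-distrib-⊕ = ·ᵣ-distrib-⊕

·-zeroˡ : ∀ {n} (A : Mat n) → 0ᵥ · A ≡ 0ᵥ
·-zeroˡ = ·ᵣ-zeroˡ

·-cube : ∀ {v} {A : Mat v} → A ⊗ (A ⊗ A) ≡ I → ∀ z → ((z · A) · A) · A ≡ z
·-cube {A = A} A³≡I z = begin
  ((z · A) · A) · A   ≡⟨ ·-assoc (z · A) A A ⟩
  (z · A) · (A ⊗ A)   ≡⟨ ·-assoc z A (A ⊗ A) ⟩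
  z · (A ⊗ (A ⊗ A))   ≡⟨ cong (z ·_) A³≡I ⟩
  z · I               ≡⟨ ·-identityʳ z ⟩
  z                   ∎
  where open ≡-Reasoning

·-cancel-invertible : ∀ {v} {P Q : Mat v} → P ⊗ Q ≡ I → ∀ x → (x · P) · Q ≡ x
·-cancel-invertible {P = P} {Q} PQ≡I x = trans (·-assoc x P Q) (trans (cong (x ·_) PQ≡I) (·-identityʳ x))

-- Counting

does⇒ : ∀ {A : Set} (a? : Dec A) → does a? ≡ true → A
does⇒ (yes a) _ = a

indicator : Bool → ℕ
indicator b = if b then 1 else 0

module _ {X : Set} where

  sumOver : List X → (X → ℕ) → ℕ
  sumOver L f = sum (List.map f L)

  count : List X → (X → Bool) → ℕ
  count L S = sumOver L (λ x → indicator (S x))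

  sumOver-cong : ∀ (L : List X) {f g : X → ℕ} → (∀ {x} → x ∈ L → f x ≡ g x) → sumOver L f ≡ sumOver L g
  sumOver-cong []      f≗g = refl
  sumOver-cong (x ∷ L) f≗g = cong₂ _+_ (f≗g (here refl)) (sumOver-cong L (f≗g ∘ there))

  sumOver-+ : ∀ (L : List X) (f g : X → ℕ) → sumOver L (λ x → f x + g x) ≡ sumOver L f + sumOver L g
  sumOver-+ []      f g = refl
  sumOver-+ (x ∷ L) f g = begin
    (f x + g x) + sumOver L (λ x → f x + g x)     ≡⟨ cong (f x + g x +_) (sumOver-+ L f g) ⟩
    (f x + g x) + (sumOver L f + sumOver L g)     ≡⟨ +-interchange (f x) (g x) (sumOver L f) (sumOver L g) ⟩
    (f x + sumOver L f) + (g x + sumOver L g)     ∎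
    where open ≡-Reasoning

  sumOver-*ʳ : ∀ (L : List X) (f : X → ℕ) c → sumOver L (λ x → f x * c) ≡ sumOver L f * c
  sumOver-*ʳ []      f c = refl
  sumOver-*ʳ (x ∷ L) f c = trans (cong (f x * c +_) (sumOver-*ʳ L f c)) (sym (*-distribʳ-+ c (f x) (sumOver L f)))

  sumOver-0 : ∀ (L : List X) → sumOver L (λ _ → 0) ≡ 0
  sumOver-0 []      = refl
  sumOver-0 (_ ∷ L) = sumOver-0 L

  sumOver-++ : ∀ (L M : List X) (f : X → ℕ) → sumOver (L ++ M) f ≡ sumOver L f + sumOver M f
  sumOver-++ L M f = trans (cong sum (List.map-++ f L M)) (sum-++ (List.map f L) (List.map f M))

  sumOver-∣ : ∀ (L : List X) {f : X → ℕ} {d} → (∀ x → d ∣ f x) → d ∣ sumOver L f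
  sumOver-∣ []      d∣f = _ ∣0
  sumOver-∣ (x ∷ L) d∣f = ∣m∣n⇒∣m+n (d∣f x) (sumOver-∣ L d∣f)

  sumOver-↭ : ∀ {L M : List X} (f : X → ℕ) → L ↭ M → sumOver L f ≡ sumOver M f
  sumOver-↭ f L↭M = sum-↭ (↭-map⁺ f L↭M)

  count-false : ∀ (L : List X) {S : X → Bool} → (∀ {x} → x ∈ L → S x ≡ false) → count L S ≡ 0
  count-false []      S≡false = refl
  count-false (x ∷ L) S≡false rewrite S≡false (here refl) = count-false L (S≡false ∘ there)

  count-false⁻ : ∀ (L : List X) (S : X → Bool) → count L S ≡ 0 → ∀ {x} → x ∈ L → S x ≡ false
  count-false⁻ (y ∷ L) S #S≡0 x∈L with S y in Sy
  count-false⁻ (y ∷ L) S ()   x∈L          | true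
  count-false⁻ (y ∷ L) S #S≡0 (here refl)  | false = Sy
  count-false⁻ (y ∷ L) S #S≡0 (there x∈L) | false = count-false⁻ L S #S≡0 x∈L

  count-single : ∀ (L : List X) (S : X → Bool) {a : X} → Unique L → a ∈ L → S a ≡ true →
                 (∀ x → S x ≡ true → x ≡ a) → count L S ≡ 1
  count-single (y ∷ L) S (y∉L ∷ _) (here refl) Sa onlyA rewrite Sa =
    cong suc (count-false L others)
    where
    others : ∀ {x} → x ∈ L → S x ≡ false
    others {x} x∈L with S x in Sx
    ... | false = refl
    ... | true  = ⊥-elim (All.lookup y∉L x∈L (sym (onlyA x Sx)))
  count-single (y ∷ L) S (y∉L ∷ uL) (there a∈L) Sa onlyA with S y in Sy
  ... | true  = ⊥-elim (All.lookup y∉L a∈L (onlyA y Sy))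
  ... | false = count-single L S uL a∈L Sa onlyA

  count-∨ : ∀ (L : List X) (S T : X → Bool) → (∀ x → S x ≡ true → T x ≡ false) →
            count L (λ x → S x ∨ T x) ≡ count L S + count L T
  count-∨ []      S T disjoint = refl
  count-∨ (x ∷ L) S T disjoint with S x in Sx | T x in Tx
  ... | true  | true  = contradiction (trans (sym Tx) (disjoint x Sx)) λ ()
  ... | true  | false = cong suc (count-∨ L S T disjoint)
  ... | false | true  = trans (cong suc (count-∨ L S T disjoint)) (sym (+-suc _ _))
  ... | false | false = count-∨ L S T disjoint

module _ {X Y : Set} where

  sumOver-map : ∀ (h : Y → X) (L : List Y) (f : X → ℕ) → sumOver (List.map h L) f ≡ sumOver L (f ∘ h)
  sumOver-map h L f = cong sum (sym (List.map-∘ L))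

  sumOver-swap : ∀ (L : List X) (M : List Y) (f : X → Y → ℕ) →
                 sumOver L (λ x → sumOver M (f x)) ≡ sumOver M (λ y → sumOver L (λ x → f x y))
  sumOver-swap []      M f = sym (sumOver-0 M)
  sumOver-swap (x ∷ L) M f =
    trans (cong (sumOver M (f x) +_) (sumOver-swap L M f)) (sym (sumOver-+ M (f x) _))

  count-partition : ∀ (L : List X) (Is : List Y) (S : X → Bool) (P : Y → X → Bool) →
                    (∀ x → S x ≡ true → count Is (λ i → P i x) ≡ 1) →
                    count L S ≡ sumOver Is (λ i → count L (λ x → S x ∧ P i x))
  count-partition L Is S P exactlyOne = trans (sumOver-cong L split) (sumOver-swap L Is _)
    where
    split : ∀ {x} → x ∈ L → indicator (S x) ≡ count Is (λ i → S x ∧ P i x)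
    split {x} _ with S x in Sx
    ... | false = sym (sumOver-0 Is)
    ... | true  = sym (exactlyOne x Sx)

infix 4 _≟ᵥ_
_≟ᵥ_ : ∀ {v} → DecidableEquality (F2^ v)
_≟ᵥ_ = ≡-dec Bool._≟_

allVecs-complete : ∀ {v} (x : F2^ v) → x ∈ allVecs v
allVecs-complete []            = here refl
allVecs-complete {suc v} (false ∷ x) = ∈-++⁺ˡ (∈-map⁺ (false ∷_) (allVecs-complete x))
allVecs-complete {suc v} (true ∷ x)  =
  ∈-++⁺ʳ (List.map (false ∷_) (allVecs v)) (∈-map⁺ (true ∷_) (allVecs-complete x))

allVecs-unique : ∀ v → Unique (allVecs v)
allVecs-unique zero    = [] ∷ []
allVecs-unique (suc v) = Unique.++⁺ (Unique.map⁺ ∷-injectiveʳ (allVecs-unique v))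
                                    (Unique.map⁺ ∷-injectiveʳ (allVecs-unique v)) heads-differ
  where
  heads-differ : ∀ {w} → ¬ (w ∈ List.map (false ∷_) (allVecs v) × w ∈ List.map (true ∷_) (allVecs v))
  heads-differ (w∈false∷ , w∈true∷) with ∈-map⁻ (false ∷_) w∈false∷ | ∈-map⁻ (true ∷_) w∈true∷
  ... | _ , _ , refl | _ , _ , ()

module _ {v : ℕ} where

  open import Data.List.Membership.DecPropositional (_≟ᵥ_ {v}) using (_∈?_)

  _∈ᵇ_ : F2^ v → List (F2^ v) → Bool
  w ∈ᵇ ys = does (w ∈? ys)

  ∈ᵇ⇒∈ : ∀ {w ys} → w ∈ᵇ ys ≡ true → w ∈ ys
  ∈ᵇ⇒∈ {w} {ys} = does⇒ (w ∈? ys)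

  ∈⇒∈ᵇ : ∀ {w ys} → w ∈ ys → w ∈ᵇ ys ≡ true
  ∈⇒∈ᵇ {w} {ys} = dec-true (w ∈? ys)

  ∉⇒∈ᵇ : ∀ {w ys} → ¬ w ∈ ys → w ∈ᵇ ys ≡ false
  ∉⇒∈ᵇ {w} {ys} = dec-false (w ∈? ys)

  _∖_ : Pred v → F2^ v → Pred v
  (S ∖ a) x = S x ∧ not (does (x ≟ᵥ a))

  _⊆?_ : (S T : Pred v) → Dec (S ⊆ T)
  S ⊆? T = map′ (λ all x → All.lookup all (allVecs-complete x)) (λ S⊆T → All.tabulate λ {x} _ → S⊆T x)
                (All.all? (λ x → S x Bool.≟ true →-dec T x Bool.≟ true) (allVecs v))

  size-cong : ∀ {S T : Pred v} → (∀ x → S x ≡ T x) → size S ≡ size T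
  size-cong S≗T = sumOver-cong (allVecs v) (λ {x} _ → cong indicator (S≗T x))

  size-∅ : ∀ {S : Pred v} → (∀ x → S x ≡ false) → size S ≡ 0
  size-∅ S≡false = count-false (allVecs v) (λ {x} _ → S≡false x)

  size-∅⁻ : ∀ (S : Pred v) → size S ≡ 0 → ∀ x → S x ≡ false
  size-∅⁻ S #S≡0 x = count-false⁻ (allVecs v) S #S≡0 (allVecs-complete x)

  size-singleton : ∀ (a : F2^ v) → size (λ x → does (x ≟ᵥ a)) ≡ 1
  size-singleton a = count-single (allVecs v) _ (allVecs-unique v) (allVecs-complete a)
                       (dec-true (a ≟ᵥ a) refl) (λ x → does⇒ (x ≟ᵥ a))

  size-∨ : ∀ (S T : Pred v) → (∀ x → S x ≡ true → T x ≡ false) →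
           size (λ x → S x ∨ T x) ≡ size S + size T
  size-∨ = count-∨ (allVecs v)

  size-∖ : ∀ (S : Pred v) {a} → S a ≡ true → size (S ∖ a) ≡ size S ∸ 1
  size-∖ S {a} Sa = sym (cong (_∸ 1) (begin
    size S                                        ≡⟨ size-cong split ⟩
    size (λ x → does (x ≟ᵥ a) ∨ (S ∖ a) x)        ≡⟨ size-∨ _ (S ∖ a) disjoint ⟩
    size (λ x → does (x ≟ᵥ a)) + size (S ∖ a)     ≡⟨ cong (_+ size (S ∖ a)) (size-singleton a) ⟩
    1 + size (S ∖ a)                              ∎))
    where
    open ≡-Reasoning
    split : ∀ x → S x ≡ (does (x ≟ᵥ a) ∨ (S ∖ a) x)
    split x with x ≟ᵥ a
    ... | yes refl = Sa
    ... | no  _    = sym (∧-identityʳ (S x))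
    disjoint : ∀ x → does (x ≟ᵥ a) ≡ true → (S ∖ a) x ≡ false
    disjoint x x≡a rewrite x≡a = ∧-zeroʳ (S x)

  size-∈ᵇ : ∀ {ys : List (F2^ v)} → Unique ys → size (_∈ᵇ ys) ≡ length ys
  size-∈ᵇ {[]}     _           = size-∅ (λ _ → refl)
  size-∈ᵇ {y ∷ ys} (y∉ys ∷ uys) = begin
    size (λ w → does (w ≟ᵥ y) ∨ w ∈ᵇ ys)   ≡⟨ size-∨ _ (_∈ᵇ ys) disjoint ⟩
    size (λ w → does (w ≟ᵥ y)) + size (_∈ᵇ ys) ≡⟨ cong₂ _+_ (size-singleton y) (size-∈ᵇ uys) ⟩
    1 + length ys                           ∎
    where
    open ≡-Reasoning
    disjoint : ∀ w → does (w ≟ᵥ y) ≡ true → w ∈ᵇ ys ≡ false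
    disjoint w w≡y with does⇒ (w ≟ᵥ y) w≡y
    ... | refl = ∉⇒∈ᵇ (All¬⇒¬Any y∉ys)

  size≡length⇒⊆ : ∀ (S : Pred v) {ys : List (F2^ v)} → Unique ys → (∀ {y} → y ∈ ys → S y ≡ true) →
                  size S ≡ length ys → ∀ {w} → S w ≡ true → w ∈ ys
  size≡length⇒⊆ S {ys} uys ys⊆S #S≡#ys {w} Sw = ∈ᵇ⇒∈ (not-injective w∉rest)
    where
    rest : Pred v
    rest x = S x ∧ not (x ∈ᵇ ys)
    split : ∀ x → S x ≡ (x ∈ᵇ ys ∨ rest x)
    split x with x ∈ᵇ ys in x∈ys
    ... | true  = ys⊆S (∈ᵇ⇒∈ x∈ys)
    ... | false = sym (∧-identityʳ (S x))
    rest-disjoint : ∀ x → x ∈ᵇ ys ≡ true → rest x ≡ false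
    rest-disjoint x x∈ys = trans (cong (λ b → S x ∧ not b) x∈ys) (∧-zeroʳ (S x))
    rest≡0 : size rest ≡ 0
    rest≡0 = +-cancelˡ-≡ (length ys) _ _ (begin
      length ys + size rest           ≡⟨ cong (_+ size rest) (size-∈ᵇ uys) ⟨
      size (_∈ᵇ ys) + size rest       ≡⟨ size-∨ (_∈ᵇ ys) rest rest-disjoint ⟨
      size (λ x → x ∈ᵇ ys ∨ rest x)   ≡⟨ size-cong split ⟨
      size S                          ≡⟨ #S≡#ys ⟩
      length ys                       ≡⟨ +-identityʳ _ ⟨
      length ys + 0                   ∎)
      where open ≡-Reasoning
    w∉rest : not (w ∈ᵇ ys) ≡ false
    w∉rest = subst (λ b → b ∧ not (w ∈ᵇ ys) ≡ false) Sw (size-∅⁻ rest rest≡0 w)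

  size-∘-bijection : ∀ (S : Pred v) {h g : F2^ v → F2^ v} → (∀ x → g (h x) ≡ x) → (∀ y → h (g y) ≡ y) →
                     size (S ∘ h) ≡ size S
  size-∘-bijection S {h} {g} gh≗id hg≗id = begin
    size (S ∘ h)                         ≡⟨ sumOver-map h (allVecs v) _ ⟨
    count (List.map h (allVecs v)) S     ≡⟨ sumOver-↭ _ image↭all ⟩
    size S                               ∎
    where
    open ≡-Reasoning
    unique-image : Unique (List.map h (allVecs v))
    unique-image = Unique.map⁺ (λ {x} {y} hx≡hy → trans (sym (gh≗id x)) (trans (cong g hx≡hy) (gh≗id y)))
                               (allVecs-unique v)
    image-full : ∀ {y} → y ∈ List.map h (allVecs v) ⇔ y ∈ allVecs v
    image-full {y} = mk⇔ (λ _ → allVecs-complete y)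
                         (λ _ → subst (_∈ _) (hg≗id y) (∈-map⁺ h (allVecs-complete (g y))))
    image↭all : List.map h (allVecs v) ↭ allVecs v
    image↭all = ∼bag⇒↭ (unique∧set⇒bag unique-image (allVecs-unique v) image-full)

size-suc : ∀ {v} (S : Pred (suc v)) → size S ≡ size (S ∘ (false ∷_)) + size (S ∘ (true ∷_))
size-suc {v} S = trans (sumOver-++ (List.map (false ∷_) (allVecs v)) (List.map (true ∷_) (allVecs v)) _)
                       (cong₂ _+_ (sumOver-map (false ∷_) (allVecs v) _) (sumOver-map (true ∷_) (allVecs v) _))

size-all : ∀ {v} → size {v} (λ _ → true) ≡ 2 ^ v
size-all {zero}  = refl
size-all {suc v} = trans (size-suc {v} (λ _ → true)) (cong₂ _+_ (size-all {v}) (trans (size-all {v}) (sym (+-identityʳ _))))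

-- Planes inside a 3-space

module _ {v : ℕ} (x y : F2^ v) where

  lin : Bool → Bool → F2^ v
  lin c d = scale c x ⊕ scale d y

  span₂ : List (F2^ v)
  span₂ = lin false false ∷ lin true false ∷ lin false true ∷ lin true true ∷ []

  Independent : Set
  Independent = ∀ c d → lin c d ≡ 0ᵥ → c ≡ false × d ≡ false

module _ {v : ℕ} {x y : F2^ v} where

  lin-false-false : lin x y false false ≡ 0ᵥ
  lin-false-false = trans (cong₂ _⊕_ (scale-false x) (scale-false y)) (⊕-identityˡ 0ᵥ)

  lin-true-false : lin x y true false ≡ x
  lin-true-false = trans (cong₂ _⊕_ (scale-true x) (scale-false y)) (⊕-identityʳ x)

  lin-false-true : lin x y false true ≡ y
  lin-false-true = trans (cong₂ _⊕_ (scale-false x) (scale-true y)) (⊕-identityˡ y)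

  lin-true-true : lin x y true true ≡ x ⊕ y
  lin-true-true = cong₂ _⊕_ (scale-true x) (scale-true y)

  lin-⊕ : ∀ c d c′ d′ → lin x y c d ⊕ lin x y c′ d′ ≡ lin x y (c xor c′) (d xor d′)
  lin-⊕ c d c′ d′ = trans (⊕-interchange (scale c x) (scale d y) (scale c′ x) (scale d′ y))
                          (sym (cong₂ _⊕_ (scale-xor c c′ x) (scale-xor d d′ y)))

  lin∈span₂ : ∀ c d → lin x y c d ∈ span₂ x y
  lin∈span₂ false false = here refl
  lin∈span₂ true  false = there (here refl)
  lin∈span₂ false true  = there (there (here refl))
  lin∈span₂ true  true  = there (there (there (here refl)))

  ∈span₂⇒lin : ∀ {w} → w ∈ span₂ x y → ∃₂ λ c d → lin x y c d ≡ w
  ∈span₂⇒lin (here refl)                         = false , false , refl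
  ∈span₂⇒lin (there (here refl))                 = true  , false , refl
  ∈span₂⇒lin (there (there (here refl)))         = false , true  , refl
  ∈span₂⇒lin (there (there (there (here refl)))) = true  , true  , refl

  span₂-closed : ∀ {a b} → a ∈ span₂ x y → b ∈ span₂ x y → a ⊕ b ∈ span₂ x y
  span₂-closed a∈ b∈ with ∈span₂⇒lin a∈ | ∈span₂⇒lin b∈
  ... | c , d , refl | c′ , d′ , refl = subst (_∈ span₂ x y) (sym (lin-⊕ c d c′ d′)) (lin∈span₂ _ _)

  independent : x ≢ 0ᵥ → y ≢ 0ᵥ → x ≢ y → Independent x y
  independent x≢0 y≢0 x≢y false false _  = refl , refl
  independent x≢0 y≢0 x≢y true  false eq = ⊥-elim (x≢0 (trans (sym lin-true-false) eq))
  independent x≢0 y≢0 x≢y false true  eq = ⊥-elim (y≢0 (trans (sym lin-false-true) eq))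
  independent x≢0 y≢0 x≢y true  true  eq = ⊥-elim (x≢y (begin
    x            ≡⟨ ⊕-cancelʳ x y ⟨
    (x ⊕ y) ⊕ y  ≡⟨ cong (_⊕ y) (trans (sym lin-true-true) eq) ⟩
    0ᵥ ⊕ y       ≡⟨ ⊕-identityˡ y ⟩
    y            ∎))
    where open ≡-Reasoning

  lin-injective : Independent x y → ∀ {c d c′ d′} → lin x y c d ≡ lin x y c′ d′ → (c , d) ≡ (c′ , d′)
  lin-injective indep {c} {d} {c′} {d′} eq with indep (c xor c′) (d xor d′) sum≡0
    where
    sum≡0 : lin x y (c xor c′) (d xor d′) ≡ 0ᵥ
    sum≡0 = trans (sym (lin-⊕ c d c′ d′)) (trans (cong (_⊕ lin x y c′ d′) eq) (⊕-self _))
  ... | c⊕c′≡0 , d⊕d′≡0 = cong₂ _,_ (xor≡false⇒≡ c c′ c⊕c′≡0) (xor≡false⇒≡ d d′ d⊕d′≡0)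
    where
    xor≡false⇒≡ : ∀ a b → a xor b ≡ false → a ≡ b
    xor≡false⇒≡ false false _ = refl
    xor≡false⇒≡ true  true  _ = refl

  span₂-unique : Independent x y → Unique (span₂ x y)
  span₂-unique indep = (distinct (λ ()) ∷ distinct (λ ()) ∷ distinct (λ ()) ∷ [])
                     ∷ (distinct (λ ()) ∷ distinct (λ ()) ∷ [])
                     ∷ (distinct (λ ()) ∷ [])
                     ∷ []
                     ∷ []
    where
    distinct : ∀ {c d c′ d′} → (c , d) ≢ (c′ , d′) → lin x y c d ≢ lin x y c′ d′
    distinct cd≢c′d′ = cd≢c′d′ ∘ lin-injective indep

  span₂-isSubspace : Independent x y → IsSubspace 2 (_∈ᵇ span₂ x y)
  span₂-isSubspace indep = record
    { zero∈  = ∈⇒∈ᵇ (subst (_∈ span₂ x y) lin-false-false (here refl))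
    ; closed = λ a b a∈ b∈ → ∈⇒∈ᵇ (span₂-closed (∈ᵇ⇒∈ {w = a} a∈) (∈ᵇ⇒∈ {w = b} b∈))
    ; card   = size-∈ᵇ (span₂-unique indep)
    }

  span₂-⊆ : ∀ {k} {B : Pred v} → IsSubspace k B → B x ≡ true → B y ≡ true →
            ∀ {w} → w ∈ span₂ x y → B w ≡ true
  span₂-⊆ {B = B} B-sub Bx By w∈ with ∈span₂⇒lin w∈
  ... | c , d , refl = IsSubspace.closed B-sub _ _ (scaled∈B c x Bx) (scaled∈B d y By)
    where
    scaled∈B : ∀ c z → B z ≡ true → B (scale c z) ≡ true
    scaled∈B false z _  = subst (λ t → B t ≡ true) (sym (scale-false z)) (IsSubspace.zero∈ B-sub)
    scaled∈B true  z Bz = subst (λ t → B t ≡ true) (sym (scale-true z)) Bz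

  span₂-fixed : ∀ {A : Mat v} → x · A ≡ x → y · A ≡ y → ∀ {w} → w ∈ span₂ x y → w · A ≡ w
  span₂-fixed {A} xA≡x yA≡y w∈ with ∈span₂⇒lin w∈
  ... | c , d , refl = begin
    (scale c x ⊕ scale d y) · A             ≡⟨ ·-distrib-⊕ (scale c x) (scale d y) A ⟩
    (scale c x · A) ⊕ (scale d y · A)       ≡⟨ cong₂ _⊕_ (·ᵣ-scale c x A) (·ᵣ-scale d y A) ⟩
    scale c (x · A) ⊕ scale d (y · A)       ≡⟨ cong₂ (λ s t → scale c s ⊕ scale d t) xA≡x yA≡y ⟩
    scale c x ⊕ scale d y                   ∎
    where open ≡-Reasoning

subspace₃-cosets : ∀ {v} {x y z : F2^ v} {B : Pred v} → Independent x y → IsSubspace 3 B →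
                   B x ≡ true → B y ≡ true → B z ≡ true → ¬ z ∈ span₂ x y →
                   ∀ {w} → B w ≡ true → w ∈ span₂ x y ++ List.map (z ⊕_) (span₂ x y)
subspace₃-cosets {v} {x} {y} {z} {B} indep B-sub Bx By Bz z∉T =
  size≡length⇒⊆ B unique-cosets cosets⊆B (IsSubspace.card B-sub)
  where
  T : List (F2^ v)
  T = span₂ x y
  disjoint : ∀ {w} → ¬ (w ∈ T × w ∈ List.map (z ⊕_) T)
  disjoint (w∈T , w∈z+T) with ∈-map⁻ (z ⊕_) w∈z+T
  ... | t , t∈T , refl = z∉T (subst (_∈ T) (⊕-cancelʳ z t) (span₂-closed w∈T t∈T))
  unique-cosets : Unique (T ++ List.map (z ⊕_) T)
  unique-cosets = Unique.++⁺ (span₂-unique indep) (Unique.map⁺ (⊕-injectiveˡ z) (span₂-unique indep)) disjoint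
  cosets⊆B : ∀ {w} → w ∈ T ++ List.map (z ⊕_) T → B w ≡ true
  cosets⊆B w∈ with ∈-++⁻ T w∈
  ... | inj₁ w∈T   = span₂-⊆ B-sub Bx By w∈T
  ... | inj₂ w∈z+T with ∈-map⁻ (z ⊕_) w∈z+T
  ...   | t , t∈T , refl = IsSubspace.closed B-sub z t Bz (span₂-⊆ B-sub Bx By t∈T)

-- A permutes the two cosets T and z ⊕ T of T = span₂ x y in B; having order 3 it cannot swap them,
-- so z ↦ z ⊕ t ↦ z and hence z = z A³ = z A.
order3-fixes-subspace₃ : ∀ {v} {A : Mat v} {B : Pred v} {x y : F2^ v} → A ⊗ (A ⊗ A) ≡ I →
                         IsSubspace 3 B → (∀ {w} → B w ≡ true → B (w · A) ≡ true) →
                         Independent x y → B x ≡ true → B y ≡ true → x · A ≡ x → y · A ≡ y →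
                         ∀ {z} → B z ≡ true → z · A ≡ z
order3-fixes-subspace₃ {A = A} {B} {x} {y} A³≡I B-sub invariant indep Bx By xA≡x yA≡y {z} Bz
  with z ∈ᵇ span₂ x y in z∈ᵇT
... | true  = span₂-fixed xA≡x yA≡y (∈ᵇ⇒∈ z∈ᵇT)
... | false with ∈-++⁻ (span₂ x y) (subspace₃-cosets indep B-sub Bx By Bz z∉T (invariant Bz))
  where
  z∉T : ¬ z ∈ span₂ x y
  z∉T z∈T = contradiction (trans (sym (∈⇒∈ᵇ z∈T)) z∈ᵇT) λ ()
...   | inj₁ zA∈T = trans (sym (trans (cong (_· A) zAA≡zA) zAA≡zA)) (·-cube A³≡I z)
  where
  zAA≡zA : (z · A) · A ≡ z · A
  zAA≡zA = span₂-fixed xA≡x yA≡y zA∈T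
...   | inj₂ zA∈z+T with ∈-map⁻ (z ⊕_) zA∈z+T
...     | t , t∈T , zA≡z⊕t = trans (cong (_· A) (sym zAA≡z)) (·-cube A³≡I z)
  where
  zAA≡z : (z · A) · A ≡ z
  zAA≡z = begin
    (z · A) · A         ≡⟨ cong (_· A) zA≡z⊕t ⟩
    (z ⊕ t) · A         ≡⟨ ·-distrib-⊕ z t A ⟩
    (z · A) ⊕ (t · A)   ≡⟨ cong₂ _⊕_ zA≡z⊕t (span₂-fixed xA≡x yA≡y t∈T) ⟩
    (z ⊕ t) ⊕ t         ≡⟨ ⊕-cancelʳ z t ⟩
    z                   ∎
    where open ≡-Reasoning

-- Fixed points of A_{v,f}

Fix : ∀ {v} → Mat v → Pred v
Fix A x = does ((x · A) ≟ᵥ x)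

size-Fix-conjugate : ∀ {v} {A B P : Mat v} → Invertible P → A ⊗ P ≡ P ⊗ B → size (Fix A) ≡ size (Fix B)
size-Fix-conjugate {A = A} {B} {P} (Q , PQ≡I , QP≡I) AP≡PB = begin
  size (Fix A)
    ≡⟨ size-cong (λ x → does-⇔ (mk⇔ (to x) (from x)) ((x · A) ≟ᵥ x) (((x · P) · B) ≟ᵥ (x · P))) ⟩
  size (Fix B ∘ (_· P))
    ≡⟨ size-∘-bijection (Fix B) {h = _· P} {g = _· Q} (·-cancel-invertible {P = P} PQ≡I)
                                                      (·-cancel-invertible {P = Q} QP≡I) ⟩
  size (Fix B)
    ∎
  where
  open ≡-Reasoning
  xPB≡xAP : ∀ x → (x · P) · B ≡ (x · A) · P
  xPB≡xAP x = trans (·-assoc x P B) (trans (cong (x ·_) (sym AP≡PB)) (sym (·-assoc x A P)))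
  to : ∀ x → x · A ≡ x → (x · P) · B ≡ x · P
  to x xA≡x = trans (xPB≡xAP x) (cong (_· P) xA≡x)
  from : ∀ x → (x · P) · B ≡ x · P → x · A ≡ x
  from x xPB≡xP = begin
    x · A              ≡⟨ ·-cancel-invertible {P = P} PQ≡I (x · A) ⟨
    ((x · A) · P) · Q  ≡⟨ cong (_· Q) (trans (sym (xPB≡xAP x)) xPB≡xP) ⟩
    (x · P) · Q        ≡⟨ ·-cancel-invertible {P = P} PQ≡I x ⟩
    x                  ∎

-- A[ v , f ] is blockMatrix (v ∸ f) v, and blockMatrix 0 n is I, both by definition.
blockMatrix : ℕ → (n : ℕ) → Mat n
blockMatrix m n = tabulate λ i → tabulate λ j → Aentry m (toℕ i) (toℕ j)

private
  [2+i]/2≡1+i/2 : ∀ i → (2 + i) / 2 ≡ suc (i / 2)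
  [2+i]/2≡1+i/2 i = m/n≡1+[m∸n]/n {2 + i} (s≤s (s≤s z≤n))

  [2+i]%2≡i%2 : ∀ i → (2 + i) % 2 ≡ i % 2
  [2+i]%2≡i%2 i = %-remove-+ˡ i ∣-refl

Aentry-shift : ∀ m i j → Aentry (2 + m) (2 + i) (2 + j) ≡ Aentry m i j
Aentry-shift m i j with i <ᵇ m | j <ᵇ m
... | true  | true  rewrite [2+i]/2≡1+i/2 i | [2+i]/2≡1+i/2 j | [2+i]%2≡i%2 i | [2+i]%2≡i%2 j = refl
... | true  | false = refl
... | false | true  = refl
... | false | false = refl

Aentry-offˡ : ∀ m i j → i < 2 → Aentry (2 + m) i (2 + j) ≡ false
Aentry-offˡ m i j (s≤s z≤n) with j <ᵇ m
... | false = refl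
... | true  rewrite [2+i]/2≡1+i/2 j = refl
Aentry-offˡ m i j (s≤s (s≤s z≤n)) with j <ᵇ m
... | false = refl
... | true  rewrite [2+i]/2≡1+i/2 j = refl

Aentry-offʳ : ∀ m i j → j < 2 → Aentry (2 + m) (2 + i) j ≡ false
Aentry-offʳ m i j (s≤s z≤n) with i <ᵇ m
... | false = refl
... | true  rewrite [2+i]/2≡1+i/2 i = refl
Aentry-offʳ m i j (s≤s (s≤s z≤n)) with i <ᵇ m
... | false = refl
... | true  rewrite [2+i]/2≡1+i/2 i = refl

blockMatrix-suc² : ∀ m n → blockMatrix (2 + m) (2 + n) ≡
                   (false ∷ true ∷ 0ᵥ) ∷ (true ∷ true ∷ 0ᵥ) ∷ map (λ r → false ∷ false ∷ r) (blockMatrix m n)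
blockMatrix-suc² m n =
  cong₂ _∷_ (cong (λ r → false ∷ true ∷ r) (offBlock 0 (s≤s z≤n)))
  (cong₂ _∷_ (cong (λ r → true ∷ true ∷ r) (offBlock 1 (s≤s (s≤s z≤n))))
  (trans (tabulate-cong λ i → cong₂ _∷_ (Aentry-offʳ m (toℕ i) 0 (s≤s z≤n))
                              (cong₂ _∷_ (Aentry-offʳ m (toℕ i) 1 (s≤s (s≤s z≤n)))
                                         (tabulate-cong λ j → Aentry-shift m (toℕ i) (toℕ j))))
         (tabulate-∘ (λ r → false ∷ false ∷ r) _)))
  where
  offBlock : ∀ i → i < 2 → tabulate (λ j → Aentry (2 + m) i (2 + toℕ j)) ≡ 0ᵥ {n}
  offBlock i i<2 = trans (tabulate-cong λ j → Aentry-offˡ m i (toℕ j) i<2) tabulate-false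

·-blockMatrix-suc² : ∀ m n a b (y : F2^ n) →
                     (a ∷ b ∷ y) · blockMatrix (2 + m) (2 + n) ≡ b ∷ (a xor b) ∷ y · blockMatrix m n
·-blockMatrix-suc² m n a b y = begin
  (a ∷ b ∷ y) ·ᵣ blockMatrix (2 + m) (2 + n)
    ≡⟨ cong ((a ∷ b ∷ y) ·ᵣ_) (blockMatrix-suc² m n) ⟩
  scale a (false ∷ true ∷ 0ᵥ) ⊕ (scale b (true ∷ true ∷ 0ᵥ) ⊕ y ·ᵣ map (λ r → false ∷ false ∷ r) M)
    ≡⟨ cong (λ t → scale a (false ∷ true ∷ 0ᵥ) ⊕ (scale b (true ∷ true ∷ 0ᵥ) ⊕ t)) ·ᵣ-map-false∷² ⟩
  ((a ∧ false) xor ((b ∧ true) xor false)) ∷ ((a ∧ true) xor ((b ∧ true) xor false)) ∷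
    (scale a 0ᵥ ⊕ (scale b 0ᵥ ⊕ y ·ᵣ M))
    ≡⟨ cong₂ _∷_ (first a b) (cong₂ _∷_ (second a b) tail) ⟩
  b ∷ (a xor b) ∷ y ·ᵣ M
    ∎
  where
  open ≡-Reasoning
  M : Mat n
  M = blockMatrix m n
  ·ᵣ-map-false∷² : y ·ᵣ map (λ r → false ∷ false ∷ r) M ≡ false ∷ false ∷ y ·ᵣ M
  ·ᵣ-map-false∷² = begin
    y ·ᵣ map (λ r → false ∷ false ∷ r) M        ≡⟨ cong (y ·ᵣ_) (map-∘ (false ∷_) (false ∷_) M) ⟩
    y ·ᵣ map (false ∷_) (map (false ∷_) M)      ≡⟨ ·ᵣ-map-false∷ y (map (false ∷_) M) ⟩
    false ∷ y ·ᵣ map (false ∷_) M               ≡⟨ cong (false ∷_) (·ᵣ-map-false∷ y M) ⟩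
    false ∷ false ∷ y ·ᵣ M                      ∎
  first : ∀ a b → (a ∧ false) xor ((b ∧ true) xor false) ≡ b
  first a b = cong₂ _xor_ (∧-zeroʳ a) (trans (xor-identityʳ _) (∧-identityʳ b))
  second : ∀ a b → (a ∧ true) xor ((b ∧ true) xor false) ≡ a xor b
  second a b = cong₂ _xor_ (∧-identityʳ a) (trans (xor-identityʳ _) (∧-identityʳ b))
  tail : scale a 0ᵥ ⊕ (scale b 0ᵥ ⊕ y ·ᵣ M) ≡ y ·ᵣ M
  tail = trans (cong₂ (λ s t → s ⊕ (t ⊕ y ·ᵣ M)) (scale-0ᵥ a) (scale-0ᵥ b))
               (trans (⊕-identityˡ _) (⊕-identityˡ _))

size-Fix-blockMatrix : ∀ k f → size (Fix (blockMatrix (k * 2) (k * 2 + f))) ≡ 2 ^ f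
size-Fix-blockMatrix zero    f = trans (size-cong {v = f} λ x → dec-true ((x · I) ≟ᵥ x) (·-identityʳ x)) (size-all {f})
size-Fix-blockMatrix (suc k) f = begin
  size S
    ≡⟨ size-suc S ⟩
  size (S ∘ (false ∷_)) + size (S ∘ (true ∷_))
    ≡⟨ cong₂ _+_ (size-suc (S ∘ (false ∷_))) (size-suc (S ∘ (true ∷_))) ⟩
  (size (S₂ false false) + size (S₂ false true)) + (size (S₂ true false) + size (S₂ true true))
    ≡⟨ cong₂ _+_ (cong₂ _+_ (size-cong (S₂-fixes false false)) (size-∅ (S₂-fixes false true)))
                 (cong₂ _+_ (size-∅ (S₂-fixes true false)) (size-∅ (S₂-fixes true true))) ⟩
  (size (Fix M) + 0) + 0
    ≡⟨ trans (+-identityʳ _) (+-identityʳ _) ⟩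
  size (Fix M)
    ≡⟨ size-Fix-blockMatrix k f ⟩
  2 ^ f
    ∎
  where
  open ≡-Reasoning
  n : ℕ
  n = k * 2 + f
  M : Mat n
  M = blockMatrix (k * 2) n
  S : Pred (2 + n)
  S = Fix (blockMatrix (suc k * 2) (suc k * 2 + f))
  S₂ : Bool → Bool → Pred n
  S₂ a b y = S (a ∷ b ∷ y)
  S₂-fixes : ∀ a b y → S₂ a b y ≡ does ((b ∷ (a xor b) ∷ y · M) ≟ᵥ (a ∷ b ∷ y))
  S₂-fixes a b y = cong (λ t → does (t ≟ᵥ (a ∷ b ∷ y))) (·-blockMatrix-suc² (k * 2) n a b y)

size-Fix-A : ∀ {v f q} → f ≤ v → v ∸ f ≡ q * 2 → size (Fix A[ v , f ]) ≡ 2 ^ f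
size-Fix-A {v} {f} {q} f≤v v∸f≡q*2 rewrite v∸f≡q*2 =
  subst (λ w → size (Fix (blockMatrix (q * 2) w)) ≡ 2 ^ f) q*2+f≡v (size-Fix-blockMatrix q f)
  where
  q*2+f≡v : q * 2 + f ≡ v
  q*2+f≡v = trans (cong (_+ f) (sym v∸f≡q*2)) (m∸n+n≡m f≤v)

-- Pairs of fixed vectors and the blocks through them

module _ {v : ℕ} where

  _∩_ : Pred v → Pred v → Pred v
  (S ∩ T) x = S x ∧ T x

  distinctPairs : Pred v → F2^ v → Pred v
  distinctPairs S x y = (S x ∧ S y) ∧ not (does (y ≟ᵥ x))

  size₂ : (F2^ v → Pred v) → ℕ
  size₂ R = sumOver (allVecs v) (λ x → size (R x))

  size₂-cong : ∀ {R R′ : F2^ v → Pred v} → (∀ x y → R x y ≡ R′ x y) → size₂ R ≡ size₂ R′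
  size₂-cong R≗R′ = sumOver-cong (allVecs v) λ {x} _ → size-cong (R≗R′ x)

  size₂-distinctPairs : ∀ (S : Pred v) → size₂ (distinctPairs S) ≡ size S * (size S ∸ 1)
  size₂-distinctPairs S = trans (sumOver-cong (allVecs v) λ {x} _ → partners x) (sumOver-*ʳ (allVecs v) (indicator ∘ S) _)
    where
    partners : ∀ x → size (distinctPairs S x) ≡ indicator (S x) * (size S ∸ 1)
    partners x with S x in Sx
    ... | false = size-∅ {v = v} λ _ → refl
    ... | true  = trans (size-∖ S Sx) (sym (+-identityʳ _))

  size₂-partition : ∀ {J : Set} (Js : List J) (R : F2^ v → Pred v) (P : J → F2^ v → Pred v) →
                    (∀ x y → R x y ≡ true → count Js (λ j → P j x y) ≡ 1) →
                    size₂ R ≡ sumOver Js (λ j → size₂ (λ x y → R x y ∧ P j x y))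
  size₂-partition Js R P exactlyOne =
    trans (sumOver-cong (allVecs v) λ {x} _ → count-partition (allVecs v) Js (R x) (λ j → P j x) (exactlyOne x))
          (sumOver-swap (allVecs v) Js _)

  distinctPairs-∩ : ∀ (S T : Pred v) x y → distinctPairs S x y ∧ (T x ∧ T y) ≡ distinctPairs (S ∩ T) x y
  distinctPairs-∩ S T x y = trans (∧.xy∙z≈xz∙y (S x ∧ S y) _ (T x ∧ T y))
                                  (cong (_∧ not (does (y ≟ᵥ x))) (∧.interchange (S x) (S y) (T x) (T y)))

  size₂-∅ : ∀ {R : F2^ v → Pred v} → (∀ x y → R x y ≡ false) → size₂ R ≡ 0
  size₂-∅ R≡false = trans (sumOver-cong (allVecs v) λ {x} _ → size-∅ (R≡false x)) (sumOver-0 (allVecs v))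

  distinctPairs-cong : ∀ {S T : Pred v} → (∀ z → S z ≡ T z) → ∀ x y → distinctPairs S x y ≡ distinctPairs T x y
  distinctPairs-cong S≗T x y = cong₂ (λ s t → (s ∧ t) ∧ not (does (y ≟ᵥ x))) (S≗T x) (S≗T y)

module _ {v : ℕ} (D : STS2 v) where

  open STS2 D

  private
    through : ∀ {x y} → Independent x y →
              Σ (Fin b) λ i → (_∈ᵇ span₂ x y) ⊆ block i × (∀ j → (_∈ᵇ span₂ x y) ⊆ block j → j ≡ i)
    through {x} {y} indep = unique (_∈ᵇ span₂ x y) (span₂-isSubspace indep)

  blockThrough : ∀ {x y} → Independent x y → Fin b
  blockThrough indep = proj₁ (through indep)

  blockThrough-unique : ∀ {x y} (indep : Independent x y) {j} → block j x ≡ true → block j y ≡ true →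
                        j ≡ blockThrough indep
  blockThrough-unique indep {j} Bx By =
    proj₂ (proj₂ (through indep)) j λ w w∈ → span₂-⊆ (blockDim j) Bx By (∈ᵇ⇒∈ w∈)

  count-blocksThrough : ∀ {x y} → Independent x y → count (allFin b) (λ j → block j x ∧ block j y) ≡ 1
  count-blocksThrough {x} {y} indep =
    count-single (allFin b) _ (Unique.allFin⁺ b) (∈-allFin _) (cong₂ _∧_ (∋ lin-true-false) (∋ lin-false-true))
                 λ j Bx∧By → blockThrough-unique indep (∧-conicalˡ _ _ Bx∧By) (∧-conicalʳ _ _ Bx∧By)
    where
    ∋ : ∀ {c d w} → lin x y c d ≡ w → block (blockThrough indep) w ≡ true
    ∋ {c} {d} refl = proj₁ (proj₂ (through indep)) _ (∈⇒∈ᵇ (lin∈span₂ {x = x} {y = y} c d))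

  module _ {A : Mat v} (A³≡I : A ⊗ (A ⊗ A) ≡ I)
           (mapsBlocks : ∀ i → Σ (Fin b) λ j → IsImage (block i) A (block j)) where

    block-invariant : ∀ {x y i} → Independent x y → x · A ≡ x → y · A ≡ y →
                      block i x ≡ true → block i y ≡ true → ∀ {w} → block i w ≡ true → block i (w · A) ≡ true
    block-invariant {x} {y} {i} indep xA≡x yA≡y Bx By Bw = subst (λ k → block k _ ≡ true) j≡i (toImage Bw)
      where
      j : Fin b
      j = proj₁ (mapsBlocks i)
      toImage : ∀ {w} → block i w ≡ true → block j (w · A) ≡ true
      toImage {w} Bw = Equivalence.from (proj₂ (mapsBlocks i) (w · A)) (w , Bw , refl)
      j≡i : j ≡ i
      j≡i = trans (blockThrough-unique indep (subst (λ t → block j t ≡ true) xA≡x (toImage Bx))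
                                             (subst (λ t → block j t ≡ true) yA≡y (toImage By)))
                  (sym (blockThrough-unique indep Bx By))

    fixedPairs : F2^ v → Pred v
    fixedPairs = distinctPairs (Fix A ∖ 0ᵥ)

    fixedPair⇒ : ∀ {x y} → fixedPairs x y ≡ true → Independent x y × x · A ≡ x × y · A ≡ y
    fixedPair⇒ {x} {y} pair = independent x≢0 y≢0 x≢y , fixed Sx , fixed Sy
      where
      S : Pred v
      S = Fix A ∖ 0ᵥ
      Sx∧Sy : S x ∧ S y ≡ true
      Sx∧Sy = ∧-conicalˡ _ _ pair
      Sx : S x ≡ true
      Sx = ∧-conicalˡ (S x) _ Sx∧Sy
      Sy : S y ≡ true
      Sy = ∧-conicalʳ (S x) _ Sx∧Sy
      fixed : ∀ {z} → S z ≡ true → z · A ≡ z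
      fixed {z} Sz = does⇒ ((z · A) ≟ᵥ z) (∧-conicalˡ _ _ Sz)
      nonzero : ∀ {z} → S z ≡ true → z ≢ 0ᵥ
      nonzero {z} Sz = does⇒ (¬? (z ≟ᵥ 0ᵥ)) (∧-conicalʳ _ _ Sz)
      x≢0 : x ≢ 0ᵥ
      x≢0 = nonzero Sx
      y≢0 : y ≢ 0ᵥ
      y≢0 = nonzero Sy
      x≢y : x ≢ y
      x≢y = does⇒ (¬? (y ≟ᵥ x)) (∧-conicalʳ _ _ pair) ∘ sym

    block-fixed : ∀ {x y i} → fixedPairs x y ≡ true → block i x ≡ true → block i y ≡ true → block i ⊆ Fix A
    block-fixed {i = i} pair Bx By z Bz with fixedPair⇒ pair
    ... | indep , xA≡x , yA≡y = dec-true ((z · A) ≟ᵥ z)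
          (order3-fixes-subspace₃ A³≡I (blockDim i) (block-invariant indep xA≡x yA≡y Bx By) indep Bx By xA≡x yA≡y Bz)

    7∣fibre : ∀ i → 7 ∣ size₂ (λ x y → fixedPairs x y ∧ (block i x ∧ block i y))
    7∣fibre i with block i ⊆? Fix A
    ... | yes B⊆Fix = divides 6 (begin
      size₂ (λ x y → fixedPairs x y ∧ (B x ∧ B y))   ≡⟨ size₂-cong (distinctPairs-∩ (Fix A ∖ 0ᵥ) B) ⟩
      size₂ (distinctPairs ((Fix A ∖ 0ᵥ) ∩ B))       ≡⟨ size₂-cong (distinctPairs-cong restrict) ⟩
      size₂ (distinctPairs (B ∖ 0ᵥ))                 ≡⟨ size₂-distinctPairs (B ∖ 0ᵥ) ⟩
      size (B ∖ 0ᵥ) * (size (B ∖ 0ᵥ) ∸ 1)            ≡⟨ cong (λ n → n * (n ∸ 1)) #B∖0≡7 ⟩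
      7 * 6                                           ∎)
      where
      open ≡-Reasoning
      B : Pred v
      B = block i
      #B∖0≡7 : size (B ∖ 0ᵥ) ≡ 7
      #B∖0≡7 = trans (size-∖ B (IsSubspace.zero∈ (blockDim i))) (cong (_∸ 1) (IsSubspace.card (blockDim i)))
      restrict : ∀ z → ((Fix A ∖ 0ᵥ) ∩ B) z ≡ (B ∖ 0ᵥ) z
      restrict z with B z in Bz
      ... | false = ∧-zeroʳ _
      ... | true  rewrite B⊆Fix z Bz = ∧-identityʳ _
    ... | no B⊈Fix = subst (7 ∣_) (sym (size₂-∅ noPair)) (7 ∣0)
      where
      noPair : ∀ x y → fixedPairs x y ∧ (block i x ∧ block i y) ≡ false
      noPair x y with fixedPairs x y ∧ (block i x ∧ block i y) in pairInB
      ... | false = refl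
      ... | true  = ⊥-elim (B⊈Fix (block-fixed (∧-conicalˡ _ _ pairInB)
                                               (∧-conicalˡ _ _ Bx∧By) (∧-conicalʳ _ _ Bx∧By)))
        where
        Bx∧By : block i x ∧ block i y ≡ true
        Bx∧By = ∧-conicalʳ (fixedPairs x y) _ pairInB

    7∣size₂-fixedPairs : 7 ∣ size₂ fixedPairs
    7∣size₂-fixedPairs =
      subst (7 ∣_) (sym (size₂-partition (allFin b) fixedPairs (λ i x y → block i x ∧ block i y) exactlyOne))
                   (sumOver-∣ (allFin b) 7∣fibre)
      where
      exactlyOne : ∀ x y → fixedPairs x y ≡ true → count (allFin b) (λ i → block i x ∧ block i y) ≡ 1
      exactlyOne x y pair = count-blocksThrough (proj₁ (fixedPair⇒ pair))

    size₂-fixedPairs : ∀ {n} → size (Fix A) ≡ n → size₂ fixedPairs ≡ (n ∸ 1) * (n ∸ 1 ∸ 1)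
    size₂-fixedPairs {n} #Fix≡n = begin
      size₂ fixedPairs                                 ≡⟨ size₂-distinctPairs (Fix A ∖ 0ᵥ) ⟩
      size (Fix A ∖ 0ᵥ) * (size (Fix A ∖ 0ᵥ) ∸ 1)      ≡⟨ cong (λ m → m * (m ∸ 1)) #Fix∖0 ⟩
      (n ∸ 1) * (n ∸ 1 ∸ 1)                            ∎
      where
      open ≡-Reasoning
      #Fix∖0 : size (Fix A ∖ 0ᵥ) ≡ n ∸ 1
      #Fix∖0 = trans (size-∖ (Fix A) (dec-true ((0ᵥ · A) ≟ᵥ 0ᵥ) (·-zeroˡ A))) (cong (_∸ 1) #Fix≡n)

-- Arithmetic

8^q≡1+7t : ∀ q → ∃ λ t → 8 ^ q ≡ 1 + 7 * t
8^q≡1+7t zero    = 0 , refl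
8^q≡1+7t (suc q) with 8^q≡1+7t q
... | t , 8^q≡1+7t = 1 + 8 * t , trans (cong (8 *_) 8^q≡1+7t) (step t)
  where
  step : ∀ t → 8 * (1 + 7 * t) ≡ 1 + 7 * (1 + 8 * t)
  step = solve-∀

7∤[2^f∸1][2^f∸2] : ∀ f → f % 3 ≡ 2 → ¬ 7 ∣ (2 ^ f ∸ 1) * (2 ^ f ∸ 1 ∸ 1)
7∤[2^f∸1][2^f∸2] f f%3≡2 7∣product =
  from-no (7 ∣? 6) (∣m+n∣m⇒∣n 7∣7k+6 (m∣m*n (20 * t + 112 * (t * t))))
  where
  open ≡-Reasoning
  q t : ℕ
  q = f / 3
  t = proj₁ (8^q≡1+7t q)
  4*[1+7t] : ∀ t → 2 * (2 * (1 + 7 * t)) ≡ 4 + 28 * t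
  4*[1+7t] = solve-∀
  [3+28t][2+28t] : ∀ t → (3 + 28 * t) * (2 + 28 * t) ≡ 7 * (20 * t + 112 * (t * t)) + 6
  [3+28t][2+28t] = solve-∀
  2^f≡4+28t : 2 ^ f ≡ 4 + 28 * t
  2^f≡4+28t = begin
    2 ^ f                    ≡⟨ cong (2 ^_) (trans (m≡m%n+[m/n]*n f 3) (cong (_+ q * 3) f%3≡2)) ⟩
    2 * (2 * 2 ^ (q * 3))    ≡⟨ cong (λ e → 2 * (2 * 2 ^ e)) (*-comm q 3) ⟩
    2 * (2 * 2 ^ (3 * q))    ≡⟨ cong (λ m → 2 * (2 * m)) (^-*-assoc 2 3 q) ⟨
    2 * (2 * 8 ^ q)          ≡⟨ cong (λ m → 2 * (2 * m)) (proj₂ (8^q≡1+7t q)) ⟩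
    2 * (2 * (1 + 7 * t))    ≡⟨ 4*[1+7t] t ⟩
    4 + 28 * t               ∎
  7∣7k+6 : 7 ∣ 7 * (20 * t + 112 * (t * t)) + 6
  7∣7k+6 = subst (7 ∣_) ([3+28t][2+28t] t) (subst (λ m → 7 ∣ (m ∸ 1) * (m ∸ 1 ∸ 1)) 2^f≡4+28t 7∣product)

corollary6 : (v : ℕ) (D : STS2 v) (f : ℕ) → f < v → 2 ∣ (v ∸ f) → f % 3 ≡ 2 →
    (A : Mat v) → HasOrder3 A → OfType v f A → ¬ IsAutomorphism D A
corollary6 v D f f<v (divides q v∸f≡q*2) f%3≡2 A (A³≡I , _) (P , P-invertible , AP≡PA[v,f]) (_ , mapsBlocks) =
  7∤[2^f∸1][2^f∸2] f f%3≡2 (subst (7 ∣_) #fixedPairs (7∣size₂-fixedPairs D A³≡I mapsBlocks))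
  where
  #Fix≡2^f : size (Fix A) ≡ 2 ^ f
  #Fix≡2^f = trans (size-Fix-conjugate P-invertible AP≡PA[v,f]) (size-Fix-A {q = q} (<⇒≤ f<v) v∸f≡q*2)
  #fixedPairs : size₂ (fixedPairs D A³≡I mapsBlocks) ≡ (2 ^ f ∸ 1) * (2 ^ f ∸ 1 ∸ 1)
  #fixedPairs = size₂-fixedPairs D A³≡I mapsBlocks #Fix≡2^f
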